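{- Let $p=(p_1,\dots,p_n)$ be a probability vector that is non-decreasing in $i$ (condition $\mathcal{D}_0$) and satisfies $p_{\delta n}\le\frac{1-\epsilon}{n}$ for a constant $\delta\in(0,1)$ and some $\epsilon\in(0,1)$ (condition $\mathcal{D}_1$). Then $p$ satisfies condition $\mathcal{C}_1$ with the same $\delta$ and $\epsilon$, i.e. for all $1\le k\le\delta n$, $\sum_{i=1}^kp_i\le(1-\epsilon)\frac kn$, and for all $\delta n+1\le k\le n$, $\sum_{i=k}^np_i\ge\big(1+\epsilon\frac{\delta}{1-\delta}\big)\frac{n-k+1}{n}$.
   Context: $\delta n$ is assumed to be an integer in $[1,n]$.
   Formalization: The entries of the probability vector p and the parameter ε are rational. -}

module Defs where

open import Data.Nat using (ℕ; zero; suc; _∸_)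
open import Data.Rational using (ℚ; 0ℚ; 1ℚ; _+_; _-_; -_; _<_; _÷_; >-nonZero)
open import Data.Rational.Properties using (+-monoˡ-<; +-inverseʳ)
open import Relation.Binary.PropositionalEquality using (subst)

sumFrom : (ℕ → ℚ) → ℕ → ℕ → ℚ
sumFrom f a zero = 0ℚ
sumFrom f a (suc len) = f a + sumFrom f (suc a) len

-- Σ_{i=a}^{b} f i  (empty, i.e. 0, when b < a)
Σ[_⋯_] : ℕ → ℕ → (ℕ → ℚ) → ℚ
Σ[ a ⋯ b ] f = sumFrom f a (suc b ∸ a)

1-pos : (δ : ℚ) → δ < 1ℚ → 0ℚ < 1ℚ - δ
1-pos δ h = subst (_< 1ℚ - δ) (+-inverseʳ δ) (+-monoˡ-< (- δ) h)

odds : (δ : ℚ) → δ < 1ℚ → ℚ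
odds δ h = (δ ÷ (1ℚ - δ)) {{>-nonZero (1-pos δ h)}}

module Submission where

-- Monotonicity gives Σ_{i≤k} p_i ≤ k p_{δn} for k ≤ δn, which is the first half of C₁ by D₁; in
-- particular the first δn coordinates carry mass at most (1-ε)δ. For k > δn split the remaining
-- mass into A = Σ_{δn<i<k} p_i and T = Σ_{i≥k} p_i: since p_k separates the two blocks, A/(k-δn-1)
-- ≤ p_k ≤ T/(n-k+1), so T is at least the fraction (n-k+1)/(n-δn) of A + T ≥ 1 - (1-ε)δ.
-- As n - δn = (1-δ)n and (1 - (1-ε)δ)/(1-δ) = 1 + εδ/(1-δ), this is the second half of C₁.

open import Defs
open import Data.Nat using (ℕ; NonZero) renaming (_≤_ to _≤ℕ_; _+_ to _+ℕ_; _∸_ to _∸ℕ_)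
open import Data.Integer using (+_)
open import Data.Rational using (ℚ; 0ℚ; 1ℚ; _+_; _-_; _*_; _/_; _≤_; _<_)
open import Data.Product using (_×_)
open import Relation.Binary.PropositionalEquality using (_≡_)

open import Data.Nat as ℕ using (zero; suc; z≤n; s≤s)
import Data.Nat.Properties as ℕ
open import Data.Nat.Tactic.RingSolver as ℕ-Solver using ()
import Data.Integer as ℤ
import Data.Integer.Properties as ℤ
open import Data.Integer.Tactic.RingSolver as ℤ-Solver using ()
open import Data.Rational using (1/_; toℚᵘ; nonNegative; positive; >-nonZero)
open import Data.Rational.Properties
open import Data.Rational.Unnormalised as ℚᵘ using (mkℚᵘ; *≡*) renaming (_/_ to _/ᵘ_)
import Data.Rational.Unnormalised.Properties as ℚᵘ
open import Data.Rational.Solver using (module +-*-Solver)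
open import Data.Product using (_,_; ∃-syntax)
open import Relation.Binary.PropositionalEquality
  using (refl; sym; trans; cong; cong₂; subst; module ≡-Reasoning)

toℚᵘ-/ : ∀ a n .{{_ : NonZero n}} → toℚᵘ (+ a / n) ℚᵘ.≃ + a /ᵘ n
toℚᵘ-/ a (suc d) = toℚᵘ-fromℚᵘ (mkℚᵘ (+ a) d)

/-+-/ : ∀ a b n .{{_ : NonZero n}} → + a / n + + b / n ≡ + (a ℕ.+ b) / n
/-+-/ a b n@(suc _) = toℚᵘ-injective (begin
  toℚᵘ (+ a / n + + b / n)             ≈⟨ toℚᵘ-homo-+ (+ a / n) (+ b / n) ⟩
  toℚᵘ (+ a / n) ℚᵘ.+ toℚᵘ (+ b / n)   ≈⟨ ℚᵘ.+-cong (toℚᵘ-/ a n) (toℚᵘ-/ b n) ⟩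
  + a /ᵘ n ℚᵘ.+ + b /ᵘ n               ≈⟨ *≡* (trans (same-denominator (+ a) (+ b) (+ n))
                                                     (cong (+ (a ℕ.+ b) ℤ.*_) (sym (ℤ.pos-* n n)))) ⟩
  + (a ℕ.+ b) /ᵘ n                     ≈⟨ ℚᵘ.≃-sym (toℚᵘ-/ (a ℕ.+ b) n) ⟩
  toℚᵘ (+ (a ℕ.+ b) / n)               ∎)
  where
  open ℚᵘ.≃-Reasoning
  same-denominator : ∀ x y d → (x ℤ.* d ℤ.+ y ℤ.* d) ℤ.* d ≡ (x ℤ.+ y) ℤ.* (d ℤ.* d)
  same-denominator = ℤ-Solver.solve-∀

n/n≡1 : ∀ n .{{_ : NonZero n}} → + n / n ≡ 1ℚ
n/n≡1 n@(suc _) = toℚᵘ-injective (ℚᵘ.≃-trans (toℚᵘ-/ n n) (*≡* (ℤ.*-comm (+ n) (+ 1))))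

fromℕ : ℕ → ℚ
fromℕ k = + k / 1

fromℕ-+ : ∀ a b → fromℕ (a ℕ.+ b) ≡ fromℕ a + fromℕ b
fromℕ-+ a b = sym (/-+-/ a b 1)

fromℕ-nonNeg : ∀ k → 0ℚ ≤ fromℕ k
fromℕ-nonNeg k = nonNegative⁻¹ (fromℕ k) {{normalize-nonNeg k 1}}

fromℕ-suc-* : ∀ k c → fromℕ (suc k) * c ≡ c + fromℕ k * c
fromℕ-suc-* k c = begin
  fromℕ (suc k) * c         ≡⟨ cong (_* c) (fromℕ-+ 1 k) ⟩
  (1ℚ + fromℕ k) * c        ≡⟨ *-distribʳ-+ c 1ℚ (fromℕ k) ⟩
  1ℚ * c + fromℕ k * c      ≡⟨ cong (_+ fromℕ k * c) (*-identityˡ c) ⟩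
  c + fromℕ k * c           ∎
  where open ≡-Reasoning

/≡fromℕ*1/n : ∀ k n .{{_ : NonZero n}} → + k / n ≡ fromℕ k * (+ 1 / n)
/≡fromℕ*1/n zero    n = trans (0/n≡0 n) (sym (*-zeroˡ (+ 1 / n)))
/≡fromℕ*1/n (suc k) n = begin
  + suc k / n                        ≡⟨ sym (/-+-/ 1 k n) ⟩
  + 1 / n + + k / n                  ≡⟨ cong (_+_ (+ 1 / n)) (/≡fromℕ*1/n k n) ⟩
  + 1 / n + fromℕ k * (+ 1 / n)      ≡⟨ sym (fromℕ-suc-* k (+ 1 / n)) ⟩
  fromℕ (suc k) * (+ 1 / n)          ∎
  where open ≡-Reasoning

fromℕ*1/n≡1 : ∀ n .{{_ : NonZero n}} → fromℕ n * (+ 1 / n) ≡ 1ℚ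
fromℕ*1/n≡1 n = trans (sym (/≡fromℕ*1/n n n)) (n/n≡1 n)

sumFrom-+ : ∀ f a m l → sumFrom f a (m ℕ.+ l) ≡ sumFrom f a m + sumFrom f (a ℕ.+ m) l
sumFrom-+ f a zero    l rewrite ℕ.+-identityʳ a = sym (+-identityˡ (sumFrom f a l))
sumFrom-+ f a (suc m) l rewrite ℕ.+-suc a m =
  trans (cong (_+_ (f a)) (sumFrom-+ f (suc a) m l)) (sym (+-assoc (f a) _ _))

sumFrom-const : ∀ c a len → sumFrom (λ _ → c) a len ≡ fromℕ len * c
sumFrom-const c a zero      = sym (*-zeroˡ c)
sumFrom-const c a (suc len) =
  trans (cong (_+_ c) (sumFrom-const c (suc a) len)) (sym (fromℕ-suc-* len c))

sumFrom-mono-≤ : ∀ {f g} a len → (∀ i → a ℕ.≤ i → i ℕ.< a ℕ.+ len → f i ≤ g i) →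
                 sumFrom f a len ≤ sumFrom g a len
sumFrom-mono-≤ a zero      f≤g = ≤-refl
sumFrom-mono-≤ a (suc len) f≤g rewrite ℕ.+-suc a len =
  +-mono-≤ (f≤g a ℕ.≤-refl (s≤s (ℕ.m≤m+n a len)))
           (sumFrom-mono-≤ (suc a) len (λ i a<i i<end → f≤g i (ℕ.<⇒≤ a<i) i<end))

NondecreasingOn : (ℕ → ℚ) → ℕ → ℕ → Set
NondecreasingOn f lo hi = ∀ i j → lo ℕ.≤ i → i ℕ.≤ j → j ℕ.≤ hi → f i ≤ f j

module _ {f lo hi} (f-mono : NondecreasingOn f lo hi) where

  sumFrom-≤-*-later : ∀ {a len c} → lo ℕ.≤ a → a ℕ.+ len ℕ.≤ suc c → c ℕ.≤ hi →
                      sumFrom f a len ≤ fromℕ len * f c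
  sumFrom-≤-*-later {a} {len} {c} lo≤a end≤c c≤hi = ≤-trans
    (sumFrom-mono-≤ a len (λ i a≤i i<end →
      f-mono i c (ℕ.≤-trans lo≤a a≤i) (ℕ.≤-pred (ℕ.≤-trans i<end end≤c)) c≤hi))
    (≤-reflexive (sumFrom-const (f c) a len))

  *-≤-sumFrom-first : ∀ {a len} → lo ℕ.≤ a → a ℕ.+ len ℕ.≤ suc hi →
                      fromℕ len * f a ≤ sumFrom f a len
  *-≤-sumFrom-first {a} {len} lo≤a end≤hi = ≤-trans
    (≤-reflexive (sym (sumFrom-const (f a) a len)))
    (sumFrom-mono-≤ a len (λ i a≤i i<end →
      f-mono a i lo≤a a≤i (ℕ.≤-pred (ℕ.≤-trans i<end end≤hi))))

open +-*-Solver

*-odds : ∀ δ (δ<1 : δ < 1ℚ) → (1ℚ - δ) * odds δ δ<1 ≡ δ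
*-odds δ δ<1 = begin
  (1ℚ - δ) * (δ * 1/ (1ℚ - δ))   ≡⟨ solve 3 (λ a b c → a :* (b :* c) := b :* (a :* c)) refl (1ℚ - δ) δ (1/ (1ℚ - δ)) ⟩
  δ * ((1ℚ - δ) * 1/ (1ℚ - δ))   ≡⟨ cong (δ *_) (*-inverseʳ (1ℚ - δ)) ⟩
  δ * 1ℚ                         ≡⟨ *-identityʳ δ ⟩
  δ                              ∎
  where
  open ≡-Reasoning
  instance _ = >-nonZero (1-pos δ δ<1)

head-tail-balance : ∀ {A T c} j m → A ≤ fromℕ j * c → fromℕ m * c ≤ T →
                    fromℕ m * (A + T) ≤ fromℕ (j ℕ.+ m) * T
head-tail-balance {A} {T} {c} j m A≤jc mc≤T = begin
  fromℕ m * (A + T)              ≡⟨ *-distribˡ-+ (fromℕ m) A T ⟩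
  fromℕ m * A + fromℕ m * T      ≤⟨ +-monoˡ-≤ (fromℕ m * T) mA≤jT ⟩
  fromℕ j * T + fromℕ m * T      ≡⟨ sym (trans (cong (_* T) (fromℕ-+ j m)) (*-distribʳ-+ T (fromℕ j) (fromℕ m))) ⟩
  fromℕ (j ℕ.+ m) * T            ∎
  where
  open ≤-Reasoning
  mA≤jT : fromℕ m * A ≤ fromℕ j * T
  mA≤jT = begin
    fromℕ m * A                  ≤⟨ *-monoˡ-≤-nonNeg (fromℕ m) {{nonNegative (fromℕ-nonNeg m)}} A≤jc ⟩
    fromℕ m * (fromℕ j * c)      ≡⟨ solve 3 (λ a b c → a :* (b :* c) := b :* (a :* c)) refl (fromℕ m) (fromℕ j) c ⟩
    fromℕ j * (fromℕ m * c)      ≤⟨ *-monoˡ-≤-nonNeg (fromℕ j) {{nonNegative (fromℕ-nonNeg j)}} mc≤T ⟩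
    fromℕ j * T                  ∎

tail-bound : ∀ {δ ε S T m D u} (δ<1 : δ < 1ℚ) → 0ℚ ≤ m → 0ℚ ≤ u →
             1ℚ - (1ℚ - ε) * δ ≤ S → m * S ≤ D * T → D * u ≡ 1ℚ - δ →
             (1ℚ + ε * odds δ δ<1) * (m * u) ≤ T
tail-bound {δ} {ε} {S} {T} {m} {D} {u} δ<1 0≤m 0≤u S≥ mS≤DT Du≡ =
  *-cancelˡ-≤-pos (1ℚ - δ) {{positive (1-pos δ δ<1)}} (begin
    (1ℚ - δ) * ((1ℚ + ε * o) * (m * u))        ≡⟨ solve 5 (λ d e o m u →
                                                   (con 1ℚ :- d) :* ((con 1ℚ :+ e :* o) :* (m :* u))
                                                := ((con 1ℚ :- d) :+ e :* ((con 1ℚ :- d) :* o)) :* (m :* u))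
                                                   refl δ ε o m u ⟩
    ((1ℚ - δ) + ε * ((1ℚ - δ) * o)) * (m * u)  ≡⟨ cong (λ x → ((1ℚ - δ) + ε * x) * (m * u)) (*-odds δ δ<1) ⟩
    ((1ℚ - δ) + ε * δ) * (m * u)               ≡⟨ solve 4 (λ d e m u → ((con 1ℚ :- d) :+ e :* d) :* (m :* u)
                                                                  := (con 1ℚ :- (con 1ℚ :- e) :* d) :* (m :* u))
                                                   refl δ ε m u ⟩
    (1ℚ - (1ℚ - ε) * δ) * (m * u)              ≤⟨ *-monoʳ-≤-nonNeg (m * u) {{mu≥0}} S≥ ⟩
    S * (m * u)                                ≡⟨ solve 3 (λ s m u → s :* (m :* u) := (m :* s) :* u) refl S m u ⟩
    (m * S) * u                                ≤⟨ *-monoʳ-≤-nonNeg u {{nonNegative 0≤u}} mS≤DT ⟩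
    (D * T) * u                                ≡⟨ solve 3 (λ d t u → (d :* t) :* u := (d :* u) :* t) refl D T u ⟩
    (D * u) * T                                ≡⟨ cong (_* T) Du≡ ⟩
    (1ℚ - δ) * T                               ∎)
  where
  open ≤-Reasoning
  o = odds δ δ<1
  mu≥0 = nonNeg*nonNeg⇒nonNeg m {{nonNegative 0≤m}} u {{nonNegative 0≤u}}

suffix-mass-bound : ∀ {δ ε S A T c u} (δ<1 : δ < 1ℚ) j m → 0ℚ ≤ u →
                    S + (A + T) ≡ 1ℚ → S ≤ (1ℚ - ε) * δ →
                    A ≤ fromℕ j * c → fromℕ m * c ≤ T → fromℕ (j ℕ.+ m) * u ≡ 1ℚ - δ →
                    (1ℚ + ε * odds δ δ<1) * (fromℕ m * u) ≤ T
suffix-mass-bound {δ} {ε} {S} {A} {T} δ<1 j m 0≤u S+A+T≡1 S≤ A≤ T≥ Du≡ =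
  tail-bound {ε = ε} {D = fromℕ (j ℕ.+ m)} δ<1 (fromℕ-nonNeg m) 0≤u A+T≥ (head-tail-balance j m A≤ T≥) Du≡
  where
  A+T≥ : 1ℚ - (1ℚ - ε) * δ ≤ A + T
  A+T≥ = ≤-trans (+-monoʳ-≤ 1ℚ (neg-antimono-≤ S≤)) (≤-reflexive (begin
    1ℚ - S               ≡⟨ cong (_- S) (sym S+A+T≡1) ⟩
    S + (A + T) - S      ≡⟨ solve 2 (λ s x → s :+ x :- s := x) refl S (A + T) ⟩
    A + T                ∎))
    where open ≡-Reasoning

module _ (n : ℕ) .{{_ : NonZero n}} (p : ℕ → ℚ) (p-mono : NondecreasingOn p 1 n)
         (ε : ℚ) {δn : ℕ} (δn≤n : δn ℕ.≤ n) (D₁ : p δn ≤ (1ℚ - ε) * (+ 1 / n)) where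

  prefix-bound : ∀ k → k ℕ.≤ δn → sumFrom p 1 k ≤ (1ℚ - ε) * (+ k / n)
  prefix-bound k k≤δn = begin
    sumFrom p 1 k                   ≤⟨ sumFrom-≤-*-later p-mono {len = k} ℕ.≤-refl (s≤s k≤δn) δn≤n ⟩
    fromℕ k * p δn                  ≤⟨ *-monoˡ-≤-nonNeg (fromℕ k) {{nonNegative (fromℕ-nonNeg k)}} D₁ ⟩
    fromℕ k * ((1ℚ - ε) * (+ 1 / n)) ≡⟨ solve 3 (λ a b c → a :* (b :* c) := b :* (a :* c)) refl (fromℕ k) (1ℚ - ε) (+ 1 / n) ⟩
    (1ℚ - ε) * (fromℕ k * (+ 1 / n)) ≡⟨ cong ((1ℚ - ε) *_) (sym (/≡fromℕ*1/n k n)) ⟩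
    (1ℚ - ε) * (+ k / n)            ∎
    where open ≤-Reasoning

  suffix-bound : ∀ {δ} (δ<1 : δ < 1ℚ) → + δn / n ≡ δ → sumFrom p 1 n ≡ 1ℚ →
                 ∀ j m → δn ℕ.+ (j ℕ.+ m) ≡ n → suc δn ℕ.+ j ℕ.≤ n →
                 (1ℚ + ε * odds δ δ<1) * (+ m / n) ≤ sumFrom p (suc δn ℕ.+ j) m
  suffix-bound {δ} δ<1 δn/n≡δ total j m n≡ k≤n =
    subst (_≤ T) (cong ((1ℚ + ε * odds δ δ<1) *_) (sym (/≡fromℕ*1/n m n)))
      (suffix-mass-bound {ε = ε} δ<1 j m 0≤u S+A+T≡1 S≤ A≤ T≥ Du≡)
    where
    open ≡-Reasoning
    u = + 1 / n
    S = sumFrom p 1 δn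
    A = sumFrom p (suc δn) j
    T = sumFrom p (suc δn ℕ.+ j) m
    0≤u : 0ℚ ≤ u
    0≤u = nonNegative⁻¹ u {{normalize-nonNeg 1 n}}
    S+A+T≡1 : S + (A + T) ≡ 1ℚ
    S+A+T≡1 = begin
      S + (A + T)                          ≡⟨ cong (_+_ S) (sym (sumFrom-+ p (suc δn) j m)) ⟩
      S + sumFrom p (suc δn) (j ℕ.+ m)     ≡⟨ sym (sumFrom-+ p 1 δn (j ℕ.+ m)) ⟩
      sumFrom p 1 (δn ℕ.+ (j ℕ.+ m))       ≡⟨ cong (sumFrom p 1) n≡ ⟩
      sumFrom p 1 n                        ≡⟨ total ⟩
      1ℚ                                   ∎
    S≤ : S ≤ (1ℚ - ε) * δ
    S≤ = subst (λ x → S ≤ (1ℚ - ε) * x) δn/n≡δ (prefix-bound δn ℕ.≤-refl)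
    A≤ : A ≤ fromℕ j * p (suc δn ℕ.+ j)
    A≤ = sumFrom-≤-*-later p-mono {len = j} (s≤s z≤n) (ℕ.n≤1+n _) k≤n
    T≥ : fromℕ m * p (suc δn ℕ.+ j) ≤ T
    T≥ = *-≤-sumFrom-first p-mono {len = m} (s≤s z≤n) (ℕ.≤-reflexive (cong suc (trans (ℕ.+-assoc δn j m) n≡)))
    Du≡ : fromℕ (j ℕ.+ m) * u ≡ 1ℚ - δ
    Du≡ = begin
      fromℕ (j ℕ.+ m) * u                          ≡⟨ solve 2 (λ x y → x := y :+ x :- y) refl (fromℕ (j ℕ.+ m) * u) (fromℕ δn * u) ⟩
      fromℕ δn * u + fromℕ (j ℕ.+ m) * u - fromℕ δn * u
        ≡⟨ cong₂ _-_ (sym (*-distribʳ-+ u (fromℕ δn) _)) (trans (sym (/≡fromℕ*1/n δn n)) δn/n≡δ) ⟩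
      (fromℕ δn + fromℕ (j ℕ.+ m)) * u - δ         ≡⟨ cong (λ x → x * u - δ) (sym (fromℕ-+ δn (j ℕ.+ m))) ⟩
      fromℕ (δn ℕ.+ (j ℕ.+ m)) * u - δ              ≡⟨ cong (λ x → fromℕ x * u - δ) n≡ ⟩
      fromℕ n * u - δ                              ≡⟨ cong (_- δ) (fromℕ*1/n≡1 n) ⟩
      1ℚ - δ                                       ∎

suffix-split : ∀ {h k n} → h ℕ.+ 1 ℕ.≤ k → k ℕ.≤ n →
               ∃[ j ] (suc h ℕ.+ j ≡ k × h ℕ.+ (j ℕ.+ (n ℕ.∸ k ℕ.+ 1)) ≡ n)
suffix-split {h} {k} {n} h+1≤k k≤n = j , h+1+j≡k , (begin
  h ℕ.+ (j ℕ.+ (n ℕ.∸ k ℕ.+ 1))   ≡⟨ rearrange h j (n ℕ.∸ k) ⟩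
  suc h ℕ.+ j ℕ.+ (n ℕ.∸ k)       ≡⟨ cong (ℕ._+ (n ℕ.∸ k)) h+1+j≡k ⟩
  k ℕ.+ (n ℕ.∸ k)                 ≡⟨ ℕ.m+[n∸m]≡n k≤n ⟩
  n                               ∎)
  where
  open ≡-Reasoning
  h<k : suc h ℕ.≤ k
  h<k = subst (ℕ._≤ k) (ℕ.+-comm h 1) h+1≤k
  j = k ℕ.∸ suc h
  h+1+j≡k : suc h ℕ.+ j ≡ k
  h+1+j≡k = ℕ.m+[n∸m]≡n h<k
  rearrange : ∀ a b c → a ℕ.+ (b ℕ.+ (c ℕ.+ 1)) ≡ suc a ℕ.+ b ℕ.+ c
  rearrange = ℕ-Solver.solve-∀

mainTheorem11 :
    (n : ℕ) .{{_ : NonZero n}} (p : ℕ → ℚ) (δ ε : ℚ) (δn : ℕ) →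
    0ℚ < δ → (δ<1 : δ < 1ℚ) → δ * (+ n / 1) ≡ + δn / 1 → 1 ≤ℕ δn → δn ≤ℕ n →
    0ℚ < ε → ε < 1ℚ →
    (∀ i → 1 ≤ℕ i → i ≤ℕ n → 0ℚ ≤ p i) → Σ[ 1 ⋯ n ] p ≡ 1ℚ →
    (∀ i j → 1 ≤ℕ i → i ≤ℕ j → j ≤ℕ n → p i ≤ p j) →
    p δn ≤ (1ℚ - ε) * (+ 1 / n) →
    (∀ k → 1 ≤ℕ k → k ≤ℕ δn →
       Σ[ 1 ⋯ k ] p ≤ (1ℚ - ε) * (+ k / n))
    ×
    (∀ k → δn +ℕ 1 ≤ℕ k → k ≤ℕ n →
       (1ℚ + ε * odds δ δ<1) * (+ (n ∸ℕ k +ℕ 1) / n) ≤ Σ[ k ⋯ n ] p)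
mainTheorem11 n p δ ε δn _ δ<1 δ*n≡δn _ δn≤n _ _ _ total p-mono D₁ =
  (λ k _ → prefix-bound n p p-mono ε δn≤n D₁ k) , suffix
  where
  δn/n≡δ : + δn / n ≡ δ
  δn/n≡δ = begin
    + δn / n                     ≡⟨ /≡fromℕ*1/n δn n ⟩
    fromℕ δn * (+ 1 / n)         ≡⟨ cong (_* (+ 1 / n)) (sym δ*n≡δn) ⟩
    δ * fromℕ n * (+ 1 / n)      ≡⟨ *-assoc δ (fromℕ n) (+ 1 / n) ⟩
    δ * (fromℕ n * (+ 1 / n))    ≡⟨ cong (δ *_) (fromℕ*1/n≡1 n) ⟩
    δ * 1ℚ                       ≡⟨ *-identityʳ δ ⟩
    δ                            ∎
    where open ≡-Reasoning
  suffix : ∀ k → δn +ℕ 1 ≤ℕ k → k ≤ℕ n →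
           (1ℚ + ε * odds δ δ<1) * (+ (n ∸ℕ k +ℕ 1) / n) ≤ Σ[ k ⋯ n ] p
  suffix k δn<k k≤n with suffix-split δn<k k≤n
  ... | j , refl , n≡ = subst (_ ≤_) (cong (sumFrom p k) (sym length≡))
    (suffix-bound n p p-mono ε δn≤n D₁ δ<1 δn/n≡δ total j (n ∸ℕ k +ℕ 1) n≡ k≤n)
    where
    length≡ : suc n ∸ℕ k ≡ n ∸ℕ k +ℕ 1
    length≡ = trans (ℕ.+-∸-assoc 1 k≤n) (ℕ.+-comm 1 (n ∸ℕ k))
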